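{- Consider an instance of the maintenance scheduling problem (described in the context) with network $N=(V,A,s,t,u)$, job set $J\subseteq A$ and time horizon $T$. If $J$ contains a minimum $s$-$t$ cut $S$ of the network, then it is optimal to schedule all jobs in the same time period.
   Context: Maintenance scheduling problem: given a directed network $N=(V,A,s,t,u)$ (parallel arcs allowed, so $A$ is a multiset) with source $s$, sink $t$ and nonnegative integer capacities $u_a$, a set $J\subseteq A$ of arcs each of which must be shut down for exactly one of the time periods $[T]=\{1,\dots,T\}$, a schedule assigns to each $a\in J$ a period $\tau(a)\in[T]$. In period $i$, every arc $a\in J$ with $\tau(a)=i$ has capacity $0$, all other arcs have capacity $u_a$, and an $s$-$t$ flow (satisfying capacity constraints and flow conservation at all nodes other than $s,t$) is sent independently in each period. The total throughput is the sum over $i\in[T]$ of the net flow out of $s$ in period $i$; the problem is to choose the schedule and flows maximizing total throughput. An $s$-$t$ cut is the set of arcs leaving a node set $X\subseteq V$ with $s\in X$, $t\notin X$; a minimum cut is one of minimum total capacity (with respect to $u$). "Scheduling all jobs in the same time period" means $\tau$ is constant on $J$.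
   Formalization: The flows in each period, both those of the constant schedule asserted optimal and those of every competing schedule, take values in the rationals. -}

module Defs where

open import Data.Nat as ℕ using (ℕ; zero; suc)
open import Data.Fin as Fin using (Fin; _≟_)
open import Data.Bool using (Bool; true; false; if_then_else_; _∧_)
open import Data.Integer using (+_)
open import Data.Rational as ℚ using (ℚ; 0ℚ; _≤_; _+_; _-_)
open import Data.Product using (Σ; _×_; _,_)
open import Relation.Nullary using (¬_)
open import Relation.Nullary.Decidable using (⌊_⌋)
open import Relation.Binary.PropositionalEquality using (_≡_)

Σℕ : ∀ {k} → (Fin k → ℕ) → ℕ
Σℕ {zero}  f = 0
Σℕ {suc k} f = f Fin.zero ℕ.+ Σℕ (λ i → f (Fin.suc i))

Σℚ : ∀ {k} → (Fin k → ℚ) → ℚ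
Σℚ {zero}  f = 0ℚ
Σℚ {suc k} f = f Fin.zero + Σℚ (λ i → f (Fin.suc i))

-- A directed network with n nodes and m arcs (parallel arcs allowed:
-- arcs are indexed by Fin m, each with a tail and a head).
record Network (n m : ℕ) : Set where
  field
    tail head : Fin m → Fin n
    s t       : Fin n
    u         : Fin m → ℕ
open Network public

-- Job set J ⊆ A as a characteristic function; schedule τ : A → [T]
-- (values on arcs outside J are irrelevant).
JobSet : ℕ → Set
JobSet m = Fin m → Bool

Schedule : ℕ → ℕ → Set
Schedule m T = Fin m → Fin T

capAt : ∀ {n m T} → Network n m → JobSet m → Schedule m T → Fin T → Fin m → ℕ
capAt N J τ i a = if J a ∧ ⌊ τ a ≟ i ⌋ then 0 else u N a

inflow : ∀ {n m} → Network n m → (Fin m → ℚ) → Fin n → ℚ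
inflow N f v = Σℚ (λ a → if ⌊ head N a ≟ v ⌋ then f a else 0ℚ)

outflow : ∀ {n m} → Network n m → (Fin m → ℚ) → Fin n → ℚ
outflow N f v = Σℚ (λ a → if ⌊ tail N a ≟ v ⌋ then f a else 0ℚ)

IsFlow : ∀ {n m} → Network n m → (Fin m → ℕ) → (Fin m → ℚ) → Set
IsFlow N c f =
  (∀ a → (0ℚ ≤ f a) × (f a ≤ (+ c a ℚ./ 1))) ×
  (∀ v → ¬ (v ≡ s N) → ¬ (v ≡ t N) → inflow N f v ≡ outflow N f v)

value : ∀ {n m} → Network n m → (Fin m → ℚ) → ℚ
value N f = outflow N f (s N) - inflow N f (s N)

FeasibleFlows : ∀ {n m T} → Network n m → JobSet m → Schedule m T →
                (Fin T → Fin m → ℚ) → Set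
FeasibleFlows N J τ F = ∀ i → IsFlow N (capAt N J τ i) (F i)

throughput : ∀ {n m T} → Network n m → (Fin T → Fin m → ℚ) → ℚ
throughput N F = Σℚ (λ i → value N (F i))

IsSTCutSet : ∀ {n m} → Network n m → (Fin n → Bool) → Set
IsSTCutSet N X = (X (s N) ≡ true) × (X (t N) ≡ false)

leaves : ∀ {n m} → Network n m → (Fin n → Bool) → Fin m → Bool
leaves N X a = if X (tail N a) then (if X (head N a) then false else true) else false

cutCapacity : ∀ {n m} → Network n m → (Fin n → Bool) → ℕ
cutCapacity N X = Σℕ (λ a → if leaves N X a then u N a else 0)

IsMinCut : ∀ {n m} → Network n m → (Fin n → Bool) → Set
IsMinCut N X = IsSTCutSet N X ×
  (∀ Y → IsSTCutSet N Y → cutCapacity N X ℕ.≤ cutCapacity N Y)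

CutContainedIn : ∀ {n m} → Network n m → (Fin n → Bool) → JobSet m → Set
CutContainedIn N X J = ∀ a → leaves N X a ≡ true → J a ≡ true

ConstantOn : ∀ {m T} → JobSet m → Schedule m T → Set
ConstantOn J τ = ∀ a b → J a ≡ true → J b ≡ true → τ a ≡ τ b

Optimal : ∀ {n m T} → Network n m → JobSet m → Schedule m T →
          (Fin T → Fin m → ℚ) → Set
Optimal {T = T} N J τ F = FeasibleFlows N J τ F ×
  (∀ (τ' : Schedule _ T) F' → FeasibleFlows N J τ' F' →
     throughput N F' ≤ throughput N F)

-- Let c be the capacity of the minimum cut X. Every arc of δ⁺(X) is a job, so under any
-- schedule it is shut in exactly one period and open in the other T − 1; by weak duality
-- the throughput of period i is at most the capacity of X in period i, and these
-- capacities add up to (T − 1)·c. Shutting all jobs in the first period attains the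
-- bound: that period carries nothing, and every other period carries a maximum flow,
-- whose value is c by max-flow/min-cut, obtained by augmenting integral flows.
module Submission where

open import Defs
open import Data.Nat using (ℕ; _≤_)
open import Data.Fin using (Fin)
open import Data.Bool using (Bool)
open import Data.Rational using (ℚ)
open import Data.Product using (Σ; _×_)

open import Level using (0ℓ)
open import Function using (_∘_)
open import Data.Empty using (⊥-elim)
open import Data.Nat as ℕ using (zero; suc; z≤n; _<_)
import Data.Nat.Properties as ℕP
import Data.Nat.Tactic.RingSolver as ℕ-Solver
import Data.Nat.Coprimality as Coprime
import Data.Integer as ℤ
import Data.Integer.Properties as ℤP
open import Data.Fin as Fin using (_≟_)
open import Data.Fin.Properties using (any?; suc-injective)
open import Data.Fin.Subset using (Subset; _∈_; _∉_; _⊆_; _∪_; ⁅_⁆; ∣_∣)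
open import Data.Fin.Subset.Properties
  using (_∈?_; ∣p∣≤n; p⊂q⇒∣p∣<∣q∣; p⊆p∪q; x∈p∪q⁺; x∈p∪q⁻; x∈⁅x⁆; x∈⁅y⁆⇒x≡y)
open import Data.Vec.Functional using (updateAt)
open import Data.Vec.Functional.Properties using (updateAt-updates; updateAt-minimal)
open import Data.Bool using (true; false; if_then_else_; _∧_)
open import Data.Bool.Properties using (∧-zeroʳ)
open import Data.Rational using (0ℚ; 1ℚ; _+_; _-_; _*_; -_; mkℚ)
import Data.Rational as ℚ
import Data.Rational.Properties as ℚP
open import Algebra.Properties.Group ℚP.+-0-group using (x∙y⁻¹≈ε⇒x≈y; x≈y⇒x∙y⁻¹≈ε)
open import Tactic.RingSolver using (solve-∀)
open import Tactic.RingSolver.Core.AlmostCommutativeRing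
  using (AlmostCommutativeRing; fromCommutativeRing)
open import Data.Product using (_,_; proj₁; proj₂; map₂)
open import Data.Sum using (_⊎_; inj₁; inj₂; reduce)
open import Relation.Nullary using (¬_; yes; no; Dec; ¬?)
open import Relation.Nullary.Decidable
  using (⌊_⌋; _×-dec_; _⊎-dec_; isYes≗does; dec-true; dec-false; dec⇒maybe)
open import Relation.Binary.PropositionalEquality
open ≡-Reasoning

ℚ-ring : AlmostCommutativeRing 0ℓ 0ℓ
ℚ-ring = fromCommutativeRing ℚP.+-*-commutativeRing (dec⇒maybe ∘ (0ℚ ℚP.≟_))

toℚ : ℕ → ℚ
toℚ k = ℤ.+ k ℚ./ 1

toℚ≡mkℚ : ∀ k → toℚ k ≡ mkℚ (ℤ.+ k) 0 (Coprime.sym (Coprime.1-coprimeTo k))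
toℚ≡mkℚ k = ℚP.normalize-coprime (Coprime.sym (Coprime.1-coprimeTo k))

toℚ-0 : toℚ 0 ≡ 0ℚ
toℚ-0 = refl

toℚ-+ : ∀ j k → toℚ (j ℕ.+ k) ≡ toℚ j + toℚ k
toℚ-+ j k rewrite toℚ≡mkℚ j | toℚ≡mkℚ k =
  cong (ℚ._/ 1) (sym (cong₂ ℤ._+_ (ℤP.*-identityʳ (ℤ.+ j)) (ℤP.*-identityʳ (ℤ.+ k))))

toℚ-suc : ∀ k → toℚ (suc k) ≡ toℚ k + 1ℚ
toℚ-suc k = trans (toℚ-+ 1 k) (ℚP.+-comm 1ℚ (toℚ k))

toℚ-pred : ∀ {k} → 0 < k → toℚ (ℕ.pred k) ≡ toℚ k - 1ℚ
toℚ-pred {suc k} _ = trans (sym (cancel (toℚ k))) (cong (_- 1ℚ) (sym (toℚ-suc k)))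
  where
  cancel : ∀ x → x + 1ℚ - 1ℚ ≡ x
  cancel = solve-∀ ℚ-ring

toℚ-mono-≤ : ∀ {j k} → j ≤ k → toℚ j ℚ.≤ toℚ k
toℚ-mono-≤ {j} {k} j≤k rewrite toℚ≡mkℚ j | toℚ≡mkℚ k =
  ℚ.*≤* (subst₂ ℤ._≤_ (sym (ℤP.*-identityʳ (ℤ.+ j))) (sym (ℤP.*-identityʳ (ℤ.+ k))) (ℤ.+≤+ j≤k))

true≢false : true ≢ false
true≢false ()

𝟙 : Bool → ℚ
𝟙 b = if b then 1ℚ else 0ℚ

x*[y-y]≡0 : ∀ x y → x * (y - y) ≡ 0ℚ
x*[y-y]≡0 = solve-∀ ℚ-ring

x*[1-0]≡x : ∀ x → x * (1ℚ - 0ℚ) ≡ x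
x*[1-0]≡x = solve-∀ ℚ-ring

if-then-0≡*𝟙 : ∀ b x → (if b then x else 0ℚ) ≡ x * 𝟙 b
if-then-0≡*𝟙 true  x = sym (ℚP.*-identityʳ x)
if-then-0≡*𝟙 false x = sym (ℚP.*-zeroʳ x)

⌊⌋-true : ∀ {A : Set} (a? : Dec A) → A → ⌊ a? ⌋ ≡ true
⌊⌋-true a? a = trans (isYes≗does a?) (dec-true a? a)

⌊⌋-false : ∀ {A : Set} (a? : Dec A) → ¬ A → ⌊ a? ⌋ ≡ false
⌊⌋-false a? ¬a = trans (isYes≗does a?) (dec-false a? ¬a)

δ : ∀ {k} → Fin k → Fin k → ℚ
δ i j = 𝟙 ⌊ i ≟ j ⌋

δ-refl : ∀ {k} (i : Fin k) → δ i i ≡ 1ℚ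
δ-refl i = cong 𝟙 (⌊⌋-true (i ≟ i) refl)

δ-≢ : ∀ {k} {i j : Fin k} → i ≢ j → δ i j ≡ 0ℚ
δ-≢ {i = i} {j} i≢j = cong 𝟙 (⌊⌋-false (i ≟ j) i≢j)

-- Finite sums

Σℚ-cong : ∀ {k} {f g : Fin k → ℚ} → (∀ i → f i ≡ g i) → Σℚ f ≡ Σℚ g
Σℚ-cong {zero}  f≗g = refl
Σℚ-cong {suc k} f≗g = cong₂ _+_ (f≗g Fin.zero) (Σℚ-cong (f≗g ∘ Fin.suc))

Σℚ-zero : ∀ k → Σℚ {k} (λ _ → 0ℚ) ≡ 0ℚ
Σℚ-zero zero    = refl
Σℚ-zero (suc k) = trans (ℚP.+-identityˡ _) (Σℚ-zero k)

Σℚ-distrib-+ : ∀ {k} (f g : Fin k → ℚ) → Σℚ (λ i → f i + g i) ≡ Σℚ f + Σℚ g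
Σℚ-distrib-+ {zero}  f g = refl
Σℚ-distrib-+ {suc k} f g =
  trans (cong (f Fin.zero + g Fin.zero +_) (Σℚ-distrib-+ (f ∘ Fin.suc) (g ∘ Fin.suc)))
        (interchange (f Fin.zero) (g Fin.zero) (Σℚ (f ∘ Fin.suc)) (Σℚ (g ∘ Fin.suc)))
  where
  interchange : ∀ a b c d → a + b + (c + d) ≡ a + c + (b + d)
  interchange = solve-∀ ℚ-ring

Σℚ-distrib-- : ∀ {k} (f g : Fin k → ℚ) → Σℚ (λ i → f i - g i) ≡ Σℚ f - Σℚ g
Σℚ-distrib-- {zero}  f g = refl
Σℚ-distrib-- {suc k} f g =
  trans (cong (f Fin.zero - g Fin.zero +_) (Σℚ-distrib-- (f ∘ Fin.suc) (g ∘ Fin.suc)))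
        (interchange (f Fin.zero) (g Fin.zero) (Σℚ (f ∘ Fin.suc)) (Σℚ (g ∘ Fin.suc)))
  where
  interchange : ∀ a b c d → a - b + (c - d) ≡ a + c - (b + d)
  interchange = solve-∀ ℚ-ring

Σℚ-*ˡ : ∀ {k} x (f : Fin k → ℚ) → Σℚ (λ i → x * f i) ≡ x * Σℚ f
Σℚ-*ˡ {zero}  x f = sym (ℚP.*-zeroʳ x)
Σℚ-*ˡ {suc k} x f =
  trans (cong (x * f Fin.zero +_) (Σℚ-*ˡ x (f ∘ Fin.suc))) (sym (ℚP.*-distribˡ-+ x _ _))

Σℚ-comm : ∀ {k l} (f : Fin k → Fin l → ℚ) →
          Σℚ (λ i → Σℚ (λ j → f i j)) ≡ Σℚ (λ j → Σℚ (λ i → f i j))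
Σℚ-comm {zero}  {l} f = sym (Σℚ-zero l)
Σℚ-comm {suc k}     f =
  trans (cong (Σℚ (f Fin.zero) +_) (Σℚ-comm (f ∘ Fin.suc))) (sym (Σℚ-distrib-+ (f Fin.zero) _))

Σℚ-update : ∀ {k} {f f′ : Fin k → ℚ} (j : Fin k) → (∀ i → j ≢ i → f′ i ≡ f i) →
            Σℚ f′ ≡ Σℚ f + (f′ j - f j)
Σℚ-update {suc k} {f} {f′} Fin.zero same =
  trans (cong (f′ Fin.zero +_) (Σℚ-cong (λ i → same (Fin.suc i) λ ())))
        (shift (f′ Fin.zero) (f Fin.zero) (Σℚ (f ∘ Fin.suc)))
  where
  shift : ∀ x′ x r → x′ + r ≡ x + r + (x′ - x)
  shift = solve-∀ ℚ-ring
Σℚ-update {suc k} {f} {f′} (Fin.suc j) same =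
  trans (cong₂ _+_ (same Fin.zero λ ()) (Σℚ-update j λ i j≢i → same (Fin.suc i) (j≢i ∘ suc-injective)))
        (sym (ℚP.+-assoc (f Fin.zero) (Σℚ (f ∘ Fin.suc)) (f′ (Fin.suc j) - f (Fin.suc j))))

Σℚ-*δ : ∀ {k} (f : Fin k → ℚ) (j : Fin k) → Σℚ (λ i → f i * δ j i) ≡ f j
Σℚ-*δ {k} f j = begin
  Σℚ (λ i → f i * δ j i)                  ≡⟨ Σℚ-update {f = λ _ → 0ℚ} {λ i → f i * δ j i} j vanishes ⟩
  Σℚ {k} (λ _ → 0ℚ) + (f j * δ j j - 0ℚ)  ≡⟨ cong₂ (λ z d → z + (f j * d - 0ℚ)) (Σℚ-zero k) (δ-refl j) ⟩
  0ℚ + (f j * 1ℚ - 0ℚ)                    ≡⟨ simplify (f j) ⟩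
  f j                                     ∎
  where
  vanishes : ∀ i → j ≢ i → f i * δ j i ≡ 0ℚ
  vanishes i j≢i = trans (cong (f i *_) (δ-≢ j≢i)) (ℚP.*-zeroʳ (f i))
  simplify : ∀ x → 0ℚ + (x * 1ℚ - 0ℚ) ≡ x
  simplify = solve-∀ ℚ-ring

Σℚ-mono-≤ : ∀ {k} {f g : Fin k → ℚ} → (∀ i → f i ℚ.≤ g i) → Σℚ f ℚ.≤ Σℚ g
Σℚ-mono-≤ {zero}  f≤g = ℚP.≤-refl
Σℚ-mono-≤ {suc k} f≤g = ℚP.+-mono-≤ (f≤g Fin.zero) (Σℚ-mono-≤ (f≤g ∘ Fin.suc))

Σℚ-toℚ : ∀ {k} (f : Fin k → ℕ) → Σℚ (toℚ ∘ f) ≡ toℚ (Σℕ f)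
Σℚ-toℚ {zero}  f = refl
Σℚ-toℚ {suc k} f =
  trans (cong (toℚ (f Fin.zero) +_) (Σℚ-toℚ (f ∘ Fin.suc))) (sym (toℚ-+ (f Fin.zero) _))

Σℕ-cong : ∀ {k} {f g : Fin k → ℕ} → (∀ i → f i ≡ g i) → Σℕ f ≡ Σℕ g
Σℕ-cong {zero}  f≗g = refl
Σℕ-cong {suc k} f≗g = cong₂ ℕ._+_ (f≗g Fin.zero) (Σℕ-cong (f≗g ∘ Fin.suc))

Σℕ-zero : ∀ k → Σℕ {k} (λ _ → 0) ≡ 0
Σℕ-zero zero    = refl
Σℕ-zero (suc k) = Σℕ-zero k

Σℕ-const : ∀ k x → Σℕ {k} (λ _ → x) ≡ k ℕ.* x
Σℕ-const zero    x = refl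
Σℕ-const (suc k) x = cong (x ℕ.+_) (Σℕ-const k x)

Σℕ-distrib-+ : ∀ {k} (f g : Fin k → ℕ) → Σℕ (λ i → f i ℕ.+ g i) ≡ Σℕ f ℕ.+ Σℕ g
Σℕ-distrib-+ {zero}  f g = refl
Σℕ-distrib-+ {suc k} f g =
  trans (cong (f Fin.zero ℕ.+ g Fin.zero ℕ.+_) (Σℕ-distrib-+ (f ∘ Fin.suc) (g ∘ Fin.suc)))
        (interchange (f Fin.zero) (g Fin.zero) (Σℕ (f ∘ Fin.suc)) (Σℕ (g ∘ Fin.suc)))
  where
  interchange : ∀ a b c d → a ℕ.+ b ℕ.+ (c ℕ.+ d) ≡ a ℕ.+ c ℕ.+ (b ℕ.+ d)
  interchange = ℕ-Solver.solve-∀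

Σℕ-comm : ∀ {k l} (f : Fin k → Fin l → ℕ) →
          Σℕ (λ i → Σℕ (λ j → f i j)) ≡ Σℕ (λ j → Σℕ (λ i → f i j))
Σℕ-comm {zero}  {l} f = sym (Σℕ-zero l)
Σℕ-comm {suc k}     f =
  trans (cong (Σℕ (f Fin.zero) ℕ.+_) (Σℕ-comm (f ∘ Fin.suc))) (sym (Σℕ-distrib-+ (f Fin.zero) _))

Σℕ-*ˡ : ∀ {k} x (f : Fin k → ℕ) → Σℕ (λ i → x ℕ.* f i) ≡ x ℕ.* Σℕ f
Σℕ-*ˡ {zero}  x f = sym (ℕP.*-zeroʳ x)
Σℕ-*ˡ {suc k} x f =
  trans (cong (x ℕ.* f Fin.zero ℕ.+_) (Σℕ-*ˡ x (f ∘ Fin.suc))) (sym (ℕP.*-distribˡ-+ x _ _))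

Σℕ-const-but-one : ∀ {k} (f : Fin (suc k) → ℕ) (j : Fin (suc k)) x →
                   (∀ i → j ≢ i → f i ≡ x) → Σℕ f ≡ f j ℕ.+ k ℕ.* x
Σℕ-const-but-one {k} f Fin.zero x same =
  cong (f Fin.zero ℕ.+_) (trans (Σℕ-cong (λ i → same (Fin.suc i) λ ())) (Σℕ-const k x))
Σℕ-const-but-one {suc k} f (Fin.suc j) x same =
  trans (cong₂ ℕ._+_ (same Fin.zero λ ())
                     (Σℕ-const-but-one (f ∘ Fin.suc) j x λ i j≢i →
                        same (Fin.suc i) (j≢i ∘ suc-injective)))
        (exchange x (f (Fin.suc j)) (k ℕ.* x))
  where
  exchange : ∀ a b c → a ℕ.+ (b ℕ.+ c) ≡ b ℕ.+ (a ℕ.+ c)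
  exchange = ℕ-Solver.solve-∀

-- Flows in a fixed network

module FlowTheory {n m} (N : Network n m) where

  netOut : (Fin m → ℚ) → Fin n → ℚ
  netOut h v = outflow N h v - inflow N h v

  Conserves : (Fin m → ℚ) → Set
  Conserves h = ∀ v → ¬ v ≡ s N → ¬ v ≡ t N → inflow N h v ≡ outflow N h v

  balanced⇒netOut≡0 : ∀ {h v} → inflow N h v ≡ outflow N h v → netOut h v ≡ 0ℚ
  balanced⇒netOut≡0 in≡out = x≈y⇒x∙y⁻¹≈ε (sym in≡out)

  netOut≡0⇒balanced : ∀ {h v} → netOut h v ≡ 0ℚ → inflow N h v ≡ outflow N h v
  netOut≡0⇒balanced {h} {v} net≡0 = sym (x∙y⁻¹≈ε⇒x≈y (outflow N h v) (inflow N h v) net≡0)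

  incidence : Fin m → Fin n → ℚ
  incidence a v = δ (tail N a) v - δ (head N a) v

  netOut≡Σ-incidence : ∀ h v → netOut h v ≡ Σℚ (λ a → h a * incidence a v)
  netOut≡Σ-incidence h v = begin
    outflow N h v - inflow N h v
      ≡⟨ cong₂ _-_ (Σℚ-cong λ a → if-then-0≡*𝟙 _ (h a)) (Σℚ-cong λ a → if-then-0≡*𝟙 _ (h a)) ⟩
    Σℚ (λ a → h a * δ (tail N a) v) - Σℚ (λ a → h a * δ (head N a) v)
      ≡⟨ Σℚ-distrib-- (λ a → h a * δ (tail N a) v) (λ a → h a * δ (head N a) v) ⟨
    Σℚ (λ a → h a * δ (tail N a) v - h a * δ (head N a) v)
      ≡⟨ Σℚ-cong (λ a → factor (h a) (δ (tail N a) v) (δ (head N a) v)) ⟩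
    Σℚ (λ a → h a * incidence a v) ∎
    where
    factor : ∀ x y z → x * y - x * z ≡ x * (y - z)
    factor = solve-∀ ℚ-ring

  netOut-update : ∀ {h h′} (a : Fin m) → (∀ b → a ≢ b → h′ b ≡ h b) →
                  ∀ v → netOut h′ v ≡ netOut h v + (h′ a - h a) * incidence a v
  netOut-update {h} {h′} a same v = begin
    netOut h′ v
      ≡⟨ netOut≡Σ-incidence h′ v ⟩
    Σℚ (λ b → h′ b * incidence b v)
      ≡⟨ Σℚ-update a (λ b a≢b → cong (_* incidence b v) (same b a≢b)) ⟩
    Σℚ (λ b → h b * incidence b v) + (h′ a * incidence a v - h a * incidence a v)
      ≡⟨ cong₂ _+_ (sym (netOut≡Σ-incidence h v)) (factor (h′ a) (h a) (incidence a v)) ⟩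
    netOut h v + (h′ a - h a) * incidence a v ∎
    where
    factor : ∀ x y z → x * z - y * z ≡ (x - y) * z
    factor = solve-∀ ℚ-ring

  Σ-*incidence : ∀ (φ : Fin n → ℚ) a → Σℚ (λ v → φ v * incidence a v) ≡ φ (tail N a) - φ (head N a)
  Σ-*incidence φ a = begin
    Σℚ (λ v → φ v * incidence a v)
      ≡⟨ Σℚ-cong (λ v → distrib (φ v) (δ (tail N a) v) (δ (head N a) v)) ⟩
    Σℚ (λ v → φ v * δ (tail N a) v - φ v * δ (head N a) v)
      ≡⟨ Σℚ-distrib-- (λ v → φ v * δ (tail N a) v) (λ v → φ v * δ (head N a) v) ⟩
    Σℚ (λ v → φ v * δ (tail N a) v) - Σℚ (λ v → φ v * δ (head N a) v)
      ≡⟨ cong₂ _-_ (Σℚ-*δ φ (tail N a)) (Σℚ-*δ φ (head N a)) ⟩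
    φ (tail N a) - φ (head N a) ∎
    where
    distrib : ∀ x y z → x * (y - z) ≡ x * y - x * z
    distrib = solve-∀ ℚ-ring

  Σ-*netOut : ∀ (φ : Fin n → ℚ) h →
              Σℚ (λ v → φ v * netOut h v) ≡ Σℚ (λ a → h a * (φ (tail N a) - φ (head N a)))
  Σ-*netOut φ h = begin
    Σℚ (λ v → φ v * netOut h v)
      ≡⟨ Σℚ-cong (λ v → cong (φ v *_) (netOut≡Σ-incidence h v)) ⟩
    Σℚ (λ v → φ v * Σℚ (λ a → h a * incidence a v))
      ≡⟨ Σℚ-cong (λ v → Σℚ-*ˡ (φ v) (λ a → h a * incidence a v)) ⟨
    Σℚ (λ v → Σℚ (λ a → φ v * (h a * incidence a v)))
      ≡⟨ Σℚ-comm (λ v a → φ v * (h a * incidence a v)) ⟩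
    Σℚ (λ a → Σℚ (λ v → φ v * (h a * incidence a v)))
      ≡⟨ Σℚ-cong (λ a → Σℚ-cong (λ v → swap (φ v) (h a) (incidence a v))) ⟩
    Σℚ (λ a → Σℚ (λ v → h a * (φ v * incidence a v)))
      ≡⟨ Σℚ-cong (λ a → Σℚ-*ˡ (h a) (λ v → φ v * incidence a v)) ⟩
    Σℚ (λ a → h a * Σℚ (λ v → φ v * incidence a v))
      ≡⟨ Σℚ-cong (λ a → cong (h a *_) (Σ-*incidence φ a)) ⟩
    Σℚ (λ a → h a * (φ (tail N a) - φ (head N a))) ∎
    where
    swap : ∀ x y z → x * (y * z) ≡ y * (x * z)
    swap = solve-∀ ℚ-ring

  value≡Σ-across : ∀ X → IsSTCutSet N X → ∀ h → Conserves h →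
                   value N h ≡ Σℚ (λ a → h a * (𝟙 (X (tail N a)) - 𝟙 (X (head N a))))
  value≡Σ-across X (Xs , Xt) h conserves = begin
    netOut h (s N)                     ≡⟨ Σℚ-*δ (netOut h) (s N) ⟨
    Σℚ (λ v → netOut h v * δ (s N) v)  ≡⟨ Σℚ-cong only-s ⟩
    Σℚ (λ v → 𝟙 (X v) * netOut h v)    ≡⟨ Σ-*netOut (𝟙 ∘ X) h ⟩
    Σℚ (λ a → h a * (𝟙 (X (tail N a)) - 𝟙 (X (head N a)))) ∎
    where
    only-s : ∀ v → netOut h v * δ (s N) v ≡ 𝟙 (X v) * netOut h v
    only-s v with s N ≟ v
    ... | yes refl rewrite Xs = ℚP.*-comm (netOut h v) 1ℚ
    ... | no s≢v with X v in Xv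
    ...   | false = trans (ℚP.*-zeroʳ (netOut h v)) (sym (ℚP.*-zeroˡ (netOut h v)))
    ...   | true  = trans (ℚP.*-zeroʳ (netOut h v)) (sym (cong (1ℚ *_) net≡0))
      where
      net≡0 : netOut h v ≡ 0ℚ
      net≡0 = balanced⇒netOut≡0
        (conserves v (s≢v ∘ sym) (λ v≡t → true≢false (trans (sym Xv) (trans (cong X v≡t) Xt))))

  capacityAcross : (Fin n → Bool) → (Fin m → ℕ) → ℕ
  capacityAcross X c = Σℕ (λ a → if leaves N X a then c a else 0)

  weak-duality : ∀ {X c f} → IsSTCutSet N X → IsFlow N c f → value N f ℚ.≤ toℚ (capacityAcross X c)
  weak-duality {X} {c} {f} cut (bounds , conserves) =
    subst₂ ℚ._≤_ (sym (value≡Σ-across X cut f conserves))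
                 (Σℚ-toℚ (λ a → if leaves N X a then c a else 0))
                 (Σℚ-mono-≤ arc)
    where
    arc : ∀ a → f a * (𝟙 (X (tail N a)) - 𝟙 (X (head N a))) ℚ.≤ toℚ (if leaves N X a then c a else 0)
    arc a with X (tail N a) | X (head N a) | bounds a
    ... | true  | true  | _       = ℚP.≤-reflexive (trans (x*[y-y]≡0 (f a) 1ℚ) (sym toℚ-0))
    ... | true  | false | _ , f≤c = subst (ℚ._≤ toℚ (c a)) (sym (x*[1-0]≡x (f a))) f≤c
    ... | false | true  | 0≤f , _ = subst₂ ℚ._≤_ (negate (f a)) (sym toℚ-0) (ℚP.neg-antimono-≤ 0≤f)
      where
      negate : ∀ x → - x ≡ x * (0ℚ - 1ℚ)
      negate = solve-∀ ℚ-ring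
    ... | false | false | _       = ℚP.≤-reflexive (trans (x*[y-y]≡0 (f a) 0ℚ) (sym toℚ-0))

  IsIntegralFlow : (Fin m → ℕ) → Set
  IsIntegralFlow g = (∀ a → g a ≤ u N a) × Conserves (toℚ ∘ g)

  integral⇒IsFlow : ∀ {c g} → (∀ a → g a ≤ c a) → Conserves (toℚ ∘ g) → IsFlow N c (toℚ ∘ g)
  integral⇒IsFlow {c} {g} g≤c conserves =
    (λ a → subst (ℚ._≤ toℚ (g a)) toℚ-0 (toℚ-mono-≤ {0} {g a} z≤n) , toℚ-mono-≤ (g≤c a)) , conserves

  zeroFlow : Fin m → ℕ
  zeroFlow _ = 0

  netOut-zeroFlow : ∀ v → netOut (toℚ ∘ zeroFlow) v ≡ 0ℚ
  netOut-zeroFlow v = begin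
    netOut (toℚ ∘ zeroFlow) v         ≡⟨ netOut≡Σ-incidence (toℚ ∘ zeroFlow) v ⟩
    Σℚ (λ a → toℚ 0 * incidence a v)  ≡⟨ Σℚ-cong (λ a → cong (_* incidence a v) toℚ-0) ⟩
    Σℚ (λ a → 0ℚ * incidence a v)     ≡⟨ Σℚ-cong (λ a → ℚP.*-zeroˡ (incidence a v)) ⟩
    Σℚ {m} (λ _ → 0ℚ)                 ≡⟨ Σℚ-zero m ⟩
    0ℚ                                ∎

  zeroFlow-isIntegral : IsIntegralFlow zeroFlow
  zeroFlow-isIntegral = (λ _ → z≤n) , (λ v _ _ → netOut≡0⇒balanced (netOut-zeroFlow v))

  cutOf : Subset n → Fin n → Bool
  cutOf S v = ⌊ v ∈? S ⌋

  cutOf-isSTCut : ∀ {S} → s N ∈ S → t N ∉ S → IsSTCutSet N (cutOf S)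
  cutOf-isSTCut {S} s∈S t∉S = ⌊⌋-true (s N ∈? S) s∈S , ⌊⌋-false (t N ∈? S) t∉S

  value≡capacity-of-saturated-cut : ∀ {g} S → IsIntegralFlow g → s N ∈ S → t N ∉ S →
    (∀ a → tail N a ∈ S → head N a ∉ S → u N a ≤ g a) →
    (∀ a → head N a ∈ S → tail N a ∉ S → g a ≡ 0) →
    value N (toℚ ∘ g) ≡ toℚ (cutCapacity N (cutOf S))
  value≡capacity-of-saturated-cut {g} S (g≤u , conserves) s∈S t∉S saturated empty =
    trans (value≡Σ-across (cutOf S) (cutOf-isSTCut s∈S t∉S) (toℚ ∘ g) conserves)
          (trans (Σℚ-cong arc) (Σℚ-toℚ (λ a → if leaves N (cutOf S) a then u N a else 0)))
    where
    arc : ∀ a → toℚ (g a) * (𝟙 (cutOf S (tail N a)) - 𝟙 (cutOf S (head N a)))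
              ≡ toℚ (if leaves N (cutOf S) a then u N a else 0)
    arc a with tail N a ∈? S | head N a ∈? S
    ... | yes _   | yes _   = trans (x*[y-y]≡0 (toℚ (g a)) 1ℚ) (sym toℚ-0)
    ... | yes t∈S | no h∉S  = trans (x*[1-0]≡x (toℚ (g a)))
                                    (cong toℚ (ℕP.≤-antisym (g≤u a) (saturated a t∈S h∉S)))
    ... | no t∉S  | yes h∈S = begin
      toℚ (g a) * (0ℚ - 1ℚ)  ≡⟨ cong (λ k → toℚ k * (0ℚ - 1ℚ)) (empty a h∈S t∉S) ⟩
      toℚ 0 * (0ℚ - 1ℚ)      ≡⟨ cong (_* (0ℚ - 1ℚ)) toℚ-0 ⟩
      0ℚ * (0ℚ - 1ℚ)         ≡⟨ ℚP.*-zeroˡ (0ℚ - 1ℚ) ⟩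
      0ℚ                     ≡⟨ toℚ-0 ⟨
      toℚ 0                  ∎
    ... | no _    | no _    = trans (x*[y-y]≡0 (toℚ (g a)) 0ℚ) (sym toℚ-0)

  data AugmentOrCut (g : Fin m → ℕ) : Set where
    augment : ∀ g′ → IsIntegralFlow g′ → value N (toℚ ∘ g′) ≡ value N (toℚ ∘ g) + 1ℚ → AugmentOrCut g
    cut     : ∀ X → IsSTCutSet N X → value N (toℚ ∘ g) ≡ toℚ (cutCapacity N X) → AugmentOrCut g

  Inside : Subset n → Fin m → Set
  Inside S a = tail N a ∈ S × head N a ∈ S

  module Augmenting {g} (g-flow : IsIntegralFlow g) (s≢t : s N ≢ t N) where

    -- g with one more unit routed from s to w. The changes are confined to arcs inside S,
    -- so the arcs crossing the boundary of S keep the residual capacities they have under g.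
    record Augmentation (S : Subset n) (w : Fin n) : Set where
      field
        flow        : Fin m → ℕ
        flow≤u      : ∀ a → flow a ≤ u N a
        unchanged   : ∀ a → ¬ Inside S a → flow a ≡ g a
        netOut-flow : ∀ v → netOut (toℚ ∘ flow) v ≡ netOut (toℚ ∘ g) v + (δ (s N) v - δ w v)

    trivial : ∀ S → Augmentation S (s N)
    trivial S = record
      { flow        = g
      ; flow≤u      = proj₁ g-flow
      ; unchanged   = λ _ _ → refl
      ; netOut-flow = λ v → cancel (netOut (toℚ ∘ g) v) (δ (s N) v)
      }
      where
      cancel : ∀ x y → x ≡ x + (y - y)
      cancel = solve-∀ ℚ-ring

    enlarge : ∀ {S S′ w} → S ⊆ S′ → Augmentation S w → Augmentation S′ w
    enlarge S⊆S′ A = record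
      { flow        = flow
      ; flow≤u      = flow≤u
      ; unchanged   = λ a ¬in′ → unchanged a (λ (t∈ , h∈) → ¬in′ (S⊆S′ t∈ , S⊆S′ h∈))
      ; netOut-flow = netOut-flow
      }
      where open Augmentation A

    -- Changing the flow on a boundary arc a from g a to y moves the unit's endpoint from w to w′.
    extend : ∀ {S S′ w w′} → S ⊆ S′ → Augmentation S w → (a : Fin m) → ¬ Inside S a → Inside S′ a →
             (y : ℕ) → y ≤ u N a → (∀ v → (toℚ y - toℚ (g a)) * incidence a v ≡ δ w v - δ w′ v) →
             Augmentation S′ w′
    extend {S} {S′} {w} {w′} S⊆S′ A a outside inside y y≤u shift = record
      { flow        = flow′
      ; flow≤u      = flow′≤u
      ; unchanged   = unchanged′
      ; netOut-flow = netOut-flow′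
      }
      where
      open Augmentation A
      flow′ : Fin m → ℕ
      flow′ = updateAt flow a (λ _ → y)
      elsewhere : ∀ b → a ≢ b → flow′ b ≡ flow b
      elsewhere b a≢b = updateAt-minimal b a flow (a≢b ∘ sym)
      flow′≤u : ∀ b → flow′ b ≤ u N b
      flow′≤u b with a ≟ b
      ... | yes refl = subst (_≤ u N a) (sym (updateAt-updates a flow)) y≤u
      ... | no a≢b   = subst (_≤ u N b) (sym (elsewhere b a≢b)) (flow≤u b)
      unchanged′ : ∀ b → ¬ Inside S′ b → flow′ b ≡ g b
      unchanged′ b ¬in′ with a ≟ b
      ... | yes refl = ⊥-elim (¬in′ inside)
      ... | no a≢b   = trans (elsewhere b a≢b) (unchanged b λ (t∈ , h∈) → ¬in′ (S⊆S′ t∈ , S⊆S′ h∈))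
      regroup : ∀ x p q r → x + (p - q) + (q - r) ≡ x + (p - r)
      regroup = solve-∀ ℚ-ring
      netOut-flow′ : ∀ v → netOut (toℚ ∘ flow′) v ≡ netOut (toℚ ∘ g) v + (δ (s N) v - δ w′ v)
      netOut-flow′ v = begin
        netOut (toℚ ∘ flow′) v
          ≡⟨ netOut-update {toℚ ∘ flow} {toℚ ∘ flow′} a (λ b a≢b → cong toℚ (elsewhere b a≢b)) v ⟩
        netOut (toℚ ∘ flow) v + (toℚ (flow′ a) - toℚ (flow a)) * incidence a v
          ≡⟨ cong₂ (λ p q → netOut (toℚ ∘ flow) v + (toℚ p - toℚ q) * incidence a v)
                   (updateAt-updates a flow) (unchanged a outside) ⟩
        netOut (toℚ ∘ flow) v + (toℚ y - toℚ (g a)) * incidence a v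
          ≡⟨ cong₂ _+_ (netOut-flow v) (shift v) ⟩
        netOut (toℚ ∘ g) v + (δ (s N) v - δ w v) + (δ w v - δ w′ v)
          ≡⟨ regroup (netOut (toℚ ∘ g) v) (δ (s N) v) (δ w v) (δ w′ v) ⟩
        netOut (toℚ ∘ g) v + (δ (s N) v - δ w′ v) ∎

    new∈ : ∀ (S : Subset n) w → w ∈ S ∪ ⁅ w ⁆
    new∈ S w = x∈p∪q⁺ (inj₂ (x∈⁅x⁆ w))

    forward : ∀ {S} a → tail N a ∈ S → head N a ∉ S → g a < u N a →
              Augmentation S (tail N a) → Augmentation (S ∪ ⁅ head N a ⁆) (head N a)
    forward {S} a t∈S h∉S g<u A =
      extend (p⊆p∪q ⁅ head N a ⁆) A a (λ (_ , h∈S) → h∉S h∈S)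
             (p⊆p∪q ⁅ head N a ⁆ t∈S , new∈ S (head N a)) (suc (g a)) g<u shift
      where
      one-more : ∀ x p q → (x + 1ℚ - x) * (p - q) ≡ p - q
      one-more = solve-∀ ℚ-ring
      shift : ∀ v → (toℚ (suc (g a)) - toℚ (g a)) * incidence a v ≡ δ (tail N a) v - δ (head N a) v
      shift v = trans (cong (λ x → (x - toℚ (g a)) * incidence a v) (toℚ-suc (g a)))
                      (one-more (toℚ (g a)) (δ (tail N a) v) (δ (head N a) v))

    backward : ∀ {S} a → head N a ∈ S → tail N a ∉ S → 0 < g a →
               Augmentation S (head N a) → Augmentation (S ∪ ⁅ tail N a ⁆) (tail N a)
    backward {S} a h∈S t∉S 0<g A =
      extend (p⊆p∪q ⁅ tail N a ⁆) A a (λ (t∈S , _) → t∉S t∈S)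
             (new∈ S (tail N a) , p⊆p∪q ⁅ tail N a ⁆ h∈S) (ℕ.pred (g a))
             (ℕP.≤-trans ℕP.pred[n]≤n (proj₁ g-flow a)) shift
      where
      one-less : ∀ x p q → (x - 1ℚ - x) * (p - q) ≡ q - p
      one-less = solve-∀ ℚ-ring
      shift : ∀ v → (toℚ (ℕ.pred (g a)) - toℚ (g a)) * incidence a v ≡ δ (head N a) v - δ (tail N a) v
      shift v = trans (cong (λ x → (x - toℚ (g a)) * incidence a v) (toℚ-pred 0<g))
                      (one-less (toℚ (g a)) (δ (tail N a) v) (δ (head N a) v))

    grow : ∀ {S w} → (∀ {x} → x ∈ S → Augmentation S x) → Augmentation (S ∪ ⁅ w ⁆) w →
           ∀ {x} → x ∈ S ∪ ⁅ w ⁆ → Augmentation (S ∪ ⁅ w ⁆) x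
    grow {S} {w} augment-S augment-w {x} x∈ with x∈p∪q⁻ S ⁅ w ⁆ x∈
    ... | inj₁ x∈S = enlarge (p⊆p∪q ⁅ w ⁆) (augment-S x∈S)
    ... | inj₂ x∈w = subst (Augmentation (S ∪ ⁅ w ⁆)) (sym (x∈⁅y⁆⇒x≡y w x∈w)) augment-w

    fuel-step : ∀ {S w} fuel → w ∉ S → n < ∣ S ∣ ℕ.+ suc fuel → n < ∣ S ∪ ⁅ w ⁆ ∣ ℕ.+ fuel
    fuel-step {S} {w} fuel w∉S bound = ℕP.≤-trans bound
      (ℕP.≤-trans (ℕP.≤-reflexive (ℕP.+-suc ∣ S ∣ fuel)) (ℕP.+-monoˡ-≤ fuel growth))
      where
      growth : ∣ S ∣ < ∣ S ∪ ⁅ w ⁆ ∣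
      growth = p⊂q⇒∣p∣<∣q∣ (p⊆p∪q ⁅ w ⁆ , w , new∈ S w , w∉S)

    complete : ∀ {S} → Augmentation S (t N) → AugmentOrCut g
    complete A = augment flow (flow≤u , conserves) value-flow
      where
      open Augmentation A
      drop-both : ∀ x → x + (0ℚ - 0ℚ) ≡ x
      drop-both = solve-∀ ℚ-ring
      conserves : Conserves (toℚ ∘ flow)
      conserves v v≢s v≢t = netOut≡0⇒balanced (begin
        netOut (toℚ ∘ flow) v
          ≡⟨ netOut-flow v ⟩
        netOut (toℚ ∘ g) v + (δ (s N) v - δ (t N) v)
          ≡⟨ cong₂ _+_ (balanced⇒netOut≡0 (proj₂ g-flow v v≢s v≢t))
                       (cong₂ _-_ (δ-≢ (v≢s ∘ sym)) (δ-≢ (v≢t ∘ sym))) ⟩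
        0ℚ + (0ℚ - 0ℚ)
          ≡⟨ drop-both 0ℚ ⟩
        0ℚ ∎)
      one-unit : ∀ x → x + (1ℚ - 0ℚ) ≡ x + 1ℚ
      one-unit = solve-∀ ℚ-ring
      value-flow : value N (toℚ ∘ flow) ≡ value N (toℚ ∘ g) + 1ℚ
      value-flow = begin
        netOut (toℚ ∘ flow) (s N)
          ≡⟨ netOut-flow (s N) ⟩
        netOut (toℚ ∘ g) (s N) + (δ (s N) (s N) - δ (t N) (s N))
          ≡⟨ cong₂ (λ p q → netOut (toℚ ∘ g) (s N) + (p - q)) (δ-refl (s N)) (δ-≢ (s≢t ∘ sym)) ⟩
        netOut (toℚ ∘ g) (s N) + (1ℚ - 0ℚ)
          ≡⟨ one-unit (netOut (toℚ ∘ g) (s N)) ⟩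
        netOut (toℚ ∘ g) (s N) + 1ℚ ∎

    Exit : Subset n → Fin m → Set
    Exit S a = (tail N a ∈ S × head N a ∉ S × g a < u N a) ⊎ (head N a ∈ S × tail N a ∉ S × 0 < g a)

    exit? : ∀ S a → Dec (Exit S a)
    exit? S a = (tail N a ∈? S ×-dec ¬? (head N a ∈? S) ×-dec g a ℕP.<? u N a)
          ⊎-dec (head N a ∈? S ×-dec ¬? (tail N a ∈? S) ×-dec 0 ℕP.<? g a)

    -- S gains a node in every round, so the fuel n + 1 of augmentOrCut never runs out.
    search : ∀ fuel S → s N ∈ S → (∀ {x} → x ∈ S → Augmentation S x) → n < ∣ S ∣ ℕ.+ fuel →
             AugmentOrCut g
    search zero S _ _ bound =
      ⊥-elim (ℕP.<⇒≱ (subst (n <_) (ℕP.+-identityʳ ∣ S ∣) bound) (∣p∣≤n S))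
    search (suc fuel) S s∈S augment-S bound with t N ∈? S
    ... | yes t∈S = complete (augment-S t∈S)
    ... | no t∉S with any? (exit? S)
    ...   | yes (a , inj₁ (t∈S , h∉S , g<u)) =
            search fuel (S ∪ ⁅ head N a ⁆) (p⊆p∪q ⁅ head N a ⁆ s∈S)
                   (grow augment-S (forward a t∈S h∉S g<u (augment-S t∈S)))
                   (fuel-step {S} fuel h∉S bound)
    ...   | yes (a , inj₂ (h∈S , t∉S′ , 0<g)) =
            search fuel (S ∪ ⁅ tail N a ⁆) (p⊆p∪q ⁅ tail N a ⁆ s∈S)
                   (grow augment-S (backward a h∈S t∉S′ 0<g (augment-S h∈S)))
                   (fuel-step {S} fuel t∉S′ bound)
    ...   | no no-exit =
            cut (cutOf S) (cutOf-isSTCut s∈S t∉S)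
                (value≡capacity-of-saturated-cut S g-flow s∈S t∉S saturated empty)
      where
      saturated : ∀ a → tail N a ∈ S → head N a ∉ S → u N a ≤ g a
      saturated a t∈ h∉ = ℕP.≮⇒≥ (λ g<u → no-exit (a , inj₁ (t∈ , h∉ , g<u)))
      empty : ∀ a → head N a ∈ S → tail N a ∉ S → g a ≡ 0
      empty a h∈ t∉ = ℕP.n≤0⇒n≡0 (ℕP.≮⇒≥ (λ 0<g → no-exit (a , inj₂ (h∈ , t∉ , 0<g))))

    augmentOrCut : AugmentOrCut g
    augmentOrCut = search (suc n) ⁅ s N ⁆ (x∈⁅x⁆ (s N)) initial (ℕP.m≤n+m (suc n) ∣ ⁅ s N ⁆ ∣)
      where
      initial : ∀ {x} → x ∈ ⁅ s N ⁆ → Augmentation ⁅ s N ⁆ x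
      initial x∈ = subst (Augmentation ⁅ s N ⁆) (sym (x∈⁅y⁆⇒x≡y (s N) x∈)) (trivial ⁅ s N ⁆)

  maxFlow≥minCut : ∀ {X} → IsMinCut N X →
                   Σ (Fin m → ℕ) λ g → IsIntegralFlow g × toℚ (cutCapacity N X) ℚ.≤ value N (toℚ ∘ g)
  maxFlow≥minCut {X} ((Xs , Xt) , minimal) = map₂ (map₂ reduce) (reach c)
    where
    s≢t : s N ≢ t N
    s≢t s≡t = true≢false (trans (sym Xs) (trans (cong X s≡t) Xt))
    c : ℕ
    c = cutCapacity N X
    FlowAbove : ℕ → Set
    FlowAbove k = Σ (Fin m → ℕ) λ g → IsIntegralFlow g ×
                    (toℚ k ℚ.≤ value N (toℚ ∘ g) ⊎ toℚ c ℚ.≤ value N (toℚ ∘ g))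
    step : ∀ k → FlowAbove k → FlowAbove (suc k)
    step k (g , g-flow , inj₂ c≤) = g , g-flow , inj₂ c≤
    step k (g , g-flow , inj₁ k≤) = improve (Augmenting.augmentOrCut g-flow s≢t)
      where
      improve : AugmentOrCut g → FlowAbove (suc k)
      improve (augment g′ g′-flow value′) =
        g′ , g′-flow , inj₁ (subst₂ ℚ._≤_ (sym (toℚ-suc k)) (sym value′) (ℚP.+-monoˡ-≤ 1ℚ k≤))
      improve (cut Y Y-cut value≡) =
        g , g-flow , inj₂ (subst (toℚ c ℚ.≤_) (sym value≡) (toℚ-mono-≤ (minimal Y Y-cut)))
    reach : ∀ k → FlowAbove k
    reach zero    = zeroFlow , zeroFlow-isIntegral ,
                    inj₁ (subst₂ ℚ._≤_ (sym toℚ-0) (sym (netOut-zeroFlow (s N))) ℚP.≤-refl)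
    reach (suc k) = step k (reach k)

-- Scheduling

module Scheduling {n m} (N : Network n m) (J : JobSet m) {T′ : ℕ} where
  open FlowTheory N

  capAt-job : ∀ (τ : Schedule m (suc T′)) {a} i → J a ≡ true →
              capAt N J τ i a ≡ (if ⌊ τ a ≟ i ⌋ then 0 else u N a)
  capAt-job τ i Ja rewrite Ja = refl

  capacityAcross-periods : ∀ {X} → CutContainedIn N X J → (τ : Schedule m (suc T′)) →
                           Σℕ (λ i → capacityAcross X (capAt N J τ i)) ≡ T′ ℕ.* cutCapacity N X
  capacityAcross-periods {X} X⊆J τ = begin
    Σℕ (λ i → Σℕ (λ a → if leaves N X a then capAt N J τ i a else 0))
      ≡⟨ Σℕ-comm (λ i a → if leaves N X a then capAt N J τ i a else 0) ⟩
    Σℕ (λ a → Σℕ (λ i → if leaves N X a then capAt N J τ i a else 0))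
      ≡⟨ Σℕ-cong arc ⟩
    Σℕ (λ a → T′ ℕ.* (if leaves N X a then u N a else 0))
      ≡⟨ Σℕ-*ˡ T′ (λ a → if leaves N X a then u N a else 0) ⟩
    T′ ℕ.* cutCapacity N X ∎
    where
    arc : ∀ a → Σℕ (λ i → if leaves N X a then capAt N J τ i a else 0)
              ≡ T′ ℕ.* (if leaves N X a then u N a else 0)
    arc a with leaves N X a in leaving
    ... | false = trans (Σℕ-zero (suc T′)) (sym (ℕP.*-zeroʳ T′))
    ... | true  = trans (Σℕ-const-but-one (λ i → capAt N J τ i a) (τ a) (u N a) open-elsewhere)
                        (cong (ℕ._+ T′ ℕ.* u N a) shut)
      where
      Ja : J a ≡ true
      Ja = X⊆J a leaving
      shut : capAt N J τ (τ a) a ≡ 0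
      shut = trans (capAt-job τ (τ a) Ja) (cong (if_then 0 else u N a) (⌊⌋-true (τ a ≟ τ a) refl))
      open-elsewhere : ∀ i → τ a ≢ i → capAt N J τ i a ≡ u N a
      open-elsewhere i τa≢i =
        trans (capAt-job τ i Ja) (cong (if_then 0 else u N a) (⌊⌋-false (τ a ≟ i) τa≢i))

  throughput≤ : ∀ {X τ F} → IsSTCutSet N X → CutContainedIn N X J → FeasibleFlows N J τ F →
                throughput N F ℚ.≤ toℚ (T′ ℕ.* cutCapacity N X)
  throughput≤ {X} {τ} {F} X-cut X⊆J feasible =
    subst (throughput N F ℚ.≤_)
          (trans (Σℚ-toℚ (λ i → capacityAcross X (capAt N J τ i)))
                 (cong toℚ (capacityAcross-periods {X} X⊆J τ)))
          (Σℚ-mono-≤ (λ i → weak-duality {X} {capAt N J τ i} X-cut (feasible i)))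

  allInFirst : Schedule m (suc T′)
  allInFirst _ = Fin.zero

  idleThen : (Fin m → ℕ) → Fin (suc T′) → Fin m → ℚ
  idleThen g Fin.zero    = toℚ ∘ zeroFlow
  idleThen g (Fin.suc _) = toℚ ∘ g

  idleThen-feasible : ∀ {g} → IsIntegralFlow g → FeasibleFlows N J allInFirst (idleThen g)
  idleThen-feasible g-flow Fin.zero    =
    integral⇒IsFlow {capAt N J allInFirst Fin.zero} {zeroFlow} (λ _ → z≤n) (proj₂ zeroFlow-isIntegral)
  idleThen-feasible {g} (g≤u , conserves) (Fin.suc i) =
    integral⇒IsFlow {capAt N J allInFirst (Fin.suc i)} {g} open-later conserves
    where
    open-later : ∀ a → g a ≤ capAt N J allInFirst (Fin.suc i) a
    open-later a = subst (g a ≤_) (cong (if_then 0 else u N a) (sym (∧-zeroʳ (J a)))) (g≤u a)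

  throughput-idleThen : ∀ g → throughput N (idleThen g) ≡ Σℚ {T′} (λ _ → value N (toℚ ∘ g))
  throughput-idleThen g = trans (cong (_+ Σℚ {T′} (λ _ → value N (toℚ ∘ g))) (netOut-zeroFlow (s N)))
                                (ℚP.+-identityˡ (Σℚ {T′} (λ _ → value N (toℚ ∘ g))))

  throughput-idleThen≥ : ∀ {g} c → toℚ c ℚ.≤ value N (toℚ ∘ g) →
                         toℚ (T′ ℕ.* c) ℚ.≤ throughput N (idleThen g)
  throughput-idleThen≥ {g} c c≤value =
    subst₂ ℚ._≤_ (trans (Σℚ-toℚ {T′} (λ _ → c)) (cong toℚ (Σℕ-const T′ c))) (sym (throughput-idleThen g))
                 (Σℚ-mono-≤ {T′} {λ _ → toℚ c} {λ _ → value N (toℚ ∘ g)} (λ _ → c≤value))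

  idleThen-optimal : ∀ {X g} → IsSTCutSet N X → CutContainedIn N X J → IsIntegralFlow g →
                     toℚ (cutCapacity N X) ℚ.≤ value N (toℚ ∘ g) → Optimal N J allInFirst (idleThen g)
  idleThen-optimal {X} {g} X-cut X⊆J g-flow c≤value = idleThen-feasible g-flow , λ τ′ F′ feasible′ →
    ℚP.≤-trans (throughput≤ {X} X-cut X⊆J feasible′) (throughput-idleThen≥ {g} (cutCapacity N X) c≤value)

proposition4 : ∀ {n m} (N : Network n m) (J : JobSet m) (T : ℕ) → 1 ≤ T →
    (X : Fin n → Bool) → IsMinCut N X → CutContainedIn N X J →
    Σ (Schedule m T) λ τ → Σ (Fin T → Fin m → ℚ) λ F →
      ConstantOn J τ × Optimal N J τ F
proposition4 N J (suc T′) _ X X-min X⊆J =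
  let g , g-flow , c≤value = FlowTheory.maxFlow≥minCut N {X} X-min
  in allInFirst , idleThen g , (λ _ _ _ _ → refl) , idleThen-optimal {X} (proj₁ X-min) X⊆J g-flow c≤value
  where open Scheduling N J {T′}
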